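{- Let $Y$ be a $\mathrm{Sym}_n$-set with a single orbit that is $k$-supported. Then there is a surjective homomorphism of $\mathrm{Sym}_n$-sets from $[n]^{(k)}$ to $Y$.
   Context: A $\mathrm{Sym}_n$-set is a set with an action of $\mathrm{Sym}_n$; a homomorphism $f:X\to Y$ of $\mathrm{Sym}_n$-sets satisfies $f(\pi\cdot x)=\pi\cdot f(x)$. A set $S\subseteq[n]$ is a support of $y\in Y$ if every $\pi\in\mathrm{Sym}_n$ fixing $S$ pointwise satisfies $\pi\cdot y=y$; $Y$ is $k$-supported if every element has a support of size at most $k$. For $k\leq n$, $[n]^{(k)}$ is the set of $k$-tuples of pairwise distinct elements of $[n]$; for $k>n$, $[n]^{(k)}$ is the set of $k$-tuples of elements of $[n]$ whose first $n$ components are pairwise distinct and whose last $k-n$ components equal the $n$-th component. $\mathrm{Sym}_n$ acts on $[n]^{(k)}$ componentwise. -}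

module Defs where

open import Data.Nat using (ℕ; _≤_; _<_; _∸_)
open import Data.Fin using (Fin; toℕ)
open import Data.Fin.Subset using (Subset; _∈_; ∣_∣)
open import Data.Fin.Permutation using (Permutation′; _⟨$⟩ʳ_; _⟨$⟩ˡ_; inverseˡ; id; _∘ₚ_; _≈_)
open import Data.Product using (Σ; _×_; _,_; ∃)
open import Relation.Binary.PropositionalEquality using (_≡_; _≢_; cong; sym; trans)

-- Sym n := Permutation′ n  (bijections of Fin n = [n]).
-- Note: in the stdlib, (σ ∘ₚ π) ⟨$⟩ʳ i ≡ π ⟨$⟩ʳ (σ ⟨$⟩ʳ i)  ("first σ, then π"),
-- i.e. σ ∘ₚ π is the usual composite π ∘ σ.

-- Permutations are records, so the action is also
-- required to respect pointwise equality of permutations (_≈_); this just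
-- says the action is an action of the group Sym_n of bijections of [n].
record SymSet (n : ℕ) : Set₁ where
  field
    Carrier : Set
    act     : Permutation′ n → Carrier → Carrier
    act-id  : ∀ y → act id y ≡ y
    act-∘   : ∀ σ π y → act (σ ∘ₚ π) y ≡ act π (act σ y)
    act-≈   : ∀ π ρ → π ≈ ρ → ∀ y → act π y ≡ act ρ y

open SymSet public

SingleOrbit : ∀ {n} → SymSet n → Set
SingleOrbit {n} Y = Carrier Y × (∀ y y′ → ∃ λ (π : Permutation′ n) → act Y π y ≡ y′)

FixesPointwise : ∀ {n} → Permutation′ n → Subset n → Set
FixesPointwise π S = ∀ i → i ∈ S → π ⟨$⟩ʳ i ≡ i

IsSupport : ∀ {n} (Y : SymSet n) → Subset n → Carrier Y → Set
IsSupport {n} Y S y = (π : Permutation′ n) → FixesPointwise π S → act Y π y ≡ y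

KSupported : ∀ {n} → ℕ → SymSet n → Set
KSupported {n} k Y = ∀ y → ∃ λ (S : Subset n) → ∣ S ∣ ≤ k × IsSupport Y S y

-- [n]^(k): k-tuples (positions indexed 0..k-1) of elements of [n] = Fin n whose
-- first n components are pairwise distinct and whose components at positions
-- ≥ n equal the n-th component (position n-1).  For k ≤ n the second clause is vacuous.
IsTuple : (n k : ℕ) → (Fin k → Fin n) → Set
IsTuple n k v =
  (∀ i j → toℕ i < n → toℕ j < n → i ≢ j → v i ≢ v j) ×
  (∀ i j → n ≤ toℕ i → toℕ j ≡ n ∸ 1 → v i ≡ v j)

Tuples : ℕ → ℕ → Set
Tuples n k = Σ (Fin k → Fin n) (IsTuple n k)

actTuple : ∀ {n k} → Permutation′ n → Tuples n k → Tuples n k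
actTuple {n} {k} π (v , dist , tail) = (λ i → π ⟨$⟩ʳ v i) , dist′ , tail′
  where
  dist′ : ∀ i j → toℕ i < n → toℕ j < n → i ≢ j → π ⟨$⟩ʳ v i ≢ π ⟨$⟩ʳ v j
  dist′ i j p q i≢j e = dist i j p q i≢j
    (trans (sym (inverseˡ π))
      (trans (cong (π ⟨$⟩ˡ_) e) (inverseˡ π)))
  tail′ : ∀ i j → n ≤ toℕ i → toℕ j ≡ n ∸ 1 → π ⟨$⟩ʳ v i ≡ π ⟨$⟩ʳ v j
  tail′ i j p q = cong (π ⟨$⟩ʳ_) (tail i j p q)

IsHom : ∀ {n k} (Y : SymSet n) → (Tuples n k → Carrier Y) → Set
IsHom {n} Y f = ∀ (π : Permutation′ n) x → f (actTuple π x) ≡ act Y π (f x)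

Surjective : ∀ {A B : Set} → (A → B) → Set
Surjective {A} f = ∀ b → ∃ λ (a : A) → f a ≡ b

module Submission where

-- Fix y₀ ∈ Y and a support S of y₀ with ∣S∣ ≤ k.  The first
-- min(k,n) components of a tuple in [n]^(k) are pairwise distinct, so
--   (1) some base tuple x₀ ∈ [n]^(k) has all of S among its distinct
--       components (`covering-tuple`), and
--   (2) for every x ∈ [n]^(k) some permutation carries x₀ to x on the
--       distinct positions (`tuples-transitive`, from the general fact that
--       a partial injection with decidable domain extends to a permutation).
-- Put f(x) = π·y₀ for any π carrying x₀ to x.  Two such π agree on S, and
-- permutations agreeing on a support of y₀ move y₀ to the same point
-- (`support-agree`), so f(x) does not depend on the choice of π.  This
-- independence gives f(σ·x) = σ·f(x) at once, f(x₀) = y₀, and then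
-- surjectivity from transitivity of the action on Y.

open import Defs
open import Data.Nat using (ℕ; _≤_)
open import Data.Sum using (_⊎_)
open import Data.Product using (∃; _×_)

open import Data.Nat using (zero; suc; _<_; _<?_; _⊓_; z≤n; s≤s; s≤s⁻¹)
open import Data.Nat.Properties
  using (≤-trans; <-≤-trans; ≤∧≢⇒<; n≤1+n; m⊓n≤n; m≤n⇒m⊓n≡m; m≥n⇒m⊓n≡n; ⊓-idem)
open import Data.Fin as F using (Fin; toℕ; fromℕ<; _≟_)
open import Data.Fin.Properties using (toℕ-injective; toℕ-fromℕ<; toℕ<n; suc-injective)
open import Data.Fin.Subset using (Subset; _∈_; ∣_∣)
open import Data.Fin.Subset.Properties using (∣p∣≤n)
open import Data.Fin.Permutation
  using (Permutation′; _⟨$⟩ʳ_; _⟨$⟩ˡ_; inverseˡ; inverseʳ; _∘ₚ_; transpose; lift₀; flip)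
  renaming (id to idₚ)
open import Data.Vec.Base using (_∷_; []; there)
open import Data.Bool using (true; false)
open import Data.Product using (Σ; _,_; proj₁; proj₂)
open import Data.Sum using (inj₁; inj₂)
open import Data.Empty using (⊥-elim)
open import Function using (_∘_)
open import Relation.Nullary using (yes; no)
open import Relation.Nullary.Decidable using (dec-true; dec-false)
open import Relation.Unary using (Decidable)
open import Relation.Binary.PropositionalEquality
  using (_≡_; _≢_; refl; cong; sym; trans; subst; module ≡-Reasoning)

open ≡-Reasoning

transpose-source : ∀ {n} (i j : Fin n) → transpose i j ⟨$⟩ʳ i ≡ j
transpose-source i j rewrite dec-true (i ≟ i) refl = refl

transpose-other : ∀ {n} (i j l : Fin n) → l ≢ i → l ≢ j → transpose i j ⟨$⟩ʳ l ≡ l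
transpose-other i j l l≢i l≢j rewrite dec-false (l ≟ i) l≢i | dec-false (l ≟ j) l≢j = refl

permutation-injective : ∀ {n} (π : Permutation′ n) {a b : Fin n} → π ⟨$⟩ʳ a ≡ π ⟨$⟩ʳ b → a ≡ b
permutation-injective π {a} {b} e = begin
  a                    ≡⟨ sym (inverseˡ π) ⟩
  π ⟨$⟩ˡ (π ⟨$⟩ʳ a)   ≡⟨ cong (π ⟨$⟩ˡ_) e ⟩
  π ⟨$⟩ˡ (π ⟨$⟩ʳ b)   ≡⟨ inverseˡ π ⟩
  b                    ∎

InjectiveOn : ∀ {k n} → (Fin k → Set) → (Fin k → Fin n) → Set
InjectiveOn Q v = ∀ i j → Q i → Q j → i ≢ j → v i ≢ v j

restrict-suc : ∀ {k n} {Q : Fin (suc k) → Set} {v : Fin (suc k) → Fin n} →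
  InjectiveOn Q v → InjectiveOn (Q ∘ F.suc) (v ∘ F.suc)
restrict-suc v-inj i j qi qj i≢j = v-inj (F.suc i) (F.suc j) qi qj (i≢j ∘ suc-injective)

-- By induction on k, fixing position 0 with a transposition.
extend-to-permutation : ∀ {n} k (Q : Fin k → Set) → Decidable Q → (v w : Fin k → Fin n) →
  InjectiveOn Q v → InjectiveOn Q w → ∃ λ (π : Permutation′ n) → ∀ i → Q i → π ⟨$⟩ʳ v i ≡ w i
extend-to-permutation zero Q Q? v w v-inj w-inj = idₚ , λ ()
extend-to-permutation (suc k) Q Q? v w v-inj w-inj
  with extend-to-permutation k (Q ∘ F.suc) (Q? ∘ F.suc) (v ∘ F.suc) (w ∘ F.suc)
         (restrict-suc v-inj) (restrict-suc w-inj)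
     | Q? F.zero
... | π , π-maps | no ¬q₀ = π , maps
  where
  maps : ∀ i → Q i → π ⟨$⟩ʳ v i ≡ w i
  maps F.zero    q = ⊥-elim (¬q₀ q)
  maps (F.suc i) q = π-maps i q
... | π , π-maps | yes q₀ = π ∘ₚ transpose a b , maps
  where
  a = π ⟨$⟩ʳ v F.zero
  b = w F.zero
  maps : ∀ i → Q i → transpose a b ⟨$⟩ʳ (π ⟨$⟩ʳ v i) ≡ w i
  maps F.zero    q = transpose-source a b
  maps (F.suc i) q = begin
    transpose a b ⟨$⟩ʳ (π ⟨$⟩ʳ v (F.suc i))  ≡⟨ cong (transpose a b ⟨$⟩ʳ_) (π-maps i q) ⟩
    transpose a b ⟨$⟩ʳ w (F.suc i)           ≡⟨ transpose-other a b (w (F.suc i)) w≢a w≢b ⟩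
    w (F.suc i)                               ∎
    where
    w≢a : w (F.suc i) ≢ a
    w≢a e = v-inj (F.suc i) F.zero q q₀ (λ ())
              (permutation-injective π (trans (π-maps i q) e))
    w≢b : w (F.suc i) ≢ b
    w≢b = w-inj (F.suc i) F.zero q q₀ (λ ())

-- Every subset S ⊆ [n] can be permuted into the initial segment {0,…,∣S∣-1}.
-- A missing point 0 is filled by swapping it with position ∣S∣ of the tail.
gather : ∀ n (S : Subset n) → ∃ λ (τ : Permutation′ n) → ∀ s → s ∈ S → toℕ (τ ⟨$⟩ʳ s) < ∣ S ∣
gather zero [] = idₚ , λ ()
gather (suc n) (true ∷ S) with gather n S
... | τ , τ-gathers = lift₀ τ , gathers
  where
  gathers : ∀ s → s ∈ (true ∷ S) → toℕ (lift₀ τ ⟨$⟩ʳ s) < suc ∣ S ∣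
  gathers F.zero    _         = s≤s z≤n
  gathers (F.suc s) (there m) = s≤s (τ-gathers s m)
gather (suc n) (false ∷ S) with gather n S
... | τ , τ-gathers = lift₀ τ ∘ₚ transpose F.zero M , gathers
  where
  M : Fin (suc n)
  M = fromℕ< (s≤s (∣p∣≤n S))
  toℕ-M : toℕ M ≡ ∣ S ∣
  toℕ-M = toℕ-fromℕ< (s≤s (∣p∣≤n S))
  gathers : ∀ s → s ∈ (false ∷ S) → toℕ (transpose F.zero M ⟨$⟩ʳ (lift₀ τ ⟨$⟩ʳ s)) < ∣ S ∣
  -- Deciding suc (τ s) ≟ M also evaluates the transposition in the goal:
  -- the point M goes to 0 (and ∣S∣ > 0), any other point stays below ∣S∣.
  gathers (F.suc s) (there m) with F.suc (τ ⟨$⟩ʳ s) ≟ M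
  ... | yes e =
    subst (0 <_) toℕ-M (subst (λ t → 0 < toℕ t) e (s≤s z≤n))
  ... | no ne =
    ≤∧≢⇒< (τ-gathers s m) (λ e → ne (toℕ-injective (trans e (sym toℕ-M))))

Distinct : ∀ {k} (n : ℕ) → Fin k → Set
Distinct n i = toℕ i < n

Covers : ∀ {n k} → Tuples n k → (Fin n → Set) → Set
Covers {n} x P = ∀ j → P j → ∃ λ i → Distinct n i × proj₁ x i ≡ j

covers-act : ∀ {n k} (π : Permutation′ n) (x : Tuples n k) {P : Fin n → Set} →
  Covers x P → Covers (actTuple π x) (λ j → P (π ⟨$⟩ˡ j))
covers-act π x x-covers j p with x-covers (π ⟨$⟩ˡ j) p
... | i , i-distinct , xi≡ = i , i-distinct , trans (cong (π ⟨$⟩ʳ_) xi≡) (inverseʳ π)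

staircase : ∀ {n′ k} → Fin k → Fin (suc n′)
staircase {n′} i = fromℕ< (s≤s (m⊓n≤n (toℕ i) n′))

toℕ-staircase : ∀ {n′ k} (i : Fin k) → toℕ (staircase {n′} i) ≡ toℕ i ⊓ n′
toℕ-staircase {n′} i = toℕ-fromℕ< (s≤s (m⊓n≤n (toℕ i) n′))

staircase-tuple : ∀ n′ k → Tuples (suc n′) k
staircase-tuple n′ k = staircase , distinct , constant-tail
  where
  distinct : ∀ i j → toℕ i < suc n′ → toℕ j < suc n′ → i ≢ j → staircase {n′} i ≢ staircase j
  distinct i j (s≤s i≤n′) (s≤s j≤n′) i≢j e = i≢j (toℕ-injective (begin
    toℕ i                    ≡⟨ sym (m≤n⇒m⊓n≡m i≤n′) ⟩
    toℕ i ⊓ n′               ≡⟨ sym (toℕ-staircase i) ⟩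
    toℕ (staircase {n′} i)   ≡⟨ cong toℕ e ⟩
    toℕ (staircase {n′} j)   ≡⟨ toℕ-staircase j ⟩
    toℕ j ⊓ n′               ≡⟨ m≤n⇒m⊓n≡m j≤n′ ⟩
    toℕ j                    ∎))
  constant-tail : ∀ i j → suc n′ ≤ toℕ i → toℕ j ≡ n′ → staircase {n′} i ≡ staircase j
  constant-tail i j n≤i j≡n′ = toℕ-injective (begin
    toℕ (staircase {n′} i)   ≡⟨ toℕ-staircase i ⟩
    toℕ i ⊓ n′               ≡⟨ m≥n⇒m⊓n≡n (≤-trans (n≤1+n n′) n≤i) ⟩
    n′                       ≡⟨ sym (⊓-idem n′) ⟩
    n′ ⊓ n′                  ≡⟨ cong (_⊓ n′) (sym j≡n′) ⟩
    toℕ j ⊓ n′               ≡⟨ sym (toℕ-staircase j) ⟩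
    toℕ (staircase {n′} j)   ∎)

initial-tuple : ∀ n k → (k ≤ n ⊎ 1 ≤ n) → Σ (Tuples n k) λ x → Covers x (λ j → toℕ j < k)
initial-tuple n       zero    _        = ((λ ()) , (λ ()) , (λ ())) , λ j ()
initial-tuple zero    (suc k) (inj₁ ())
initial-tuple zero    (suc k) (inj₂ ())
initial-tuple (suc n′) (suc k) _       = staircase-tuple n′ (suc k) , covers
  where
  covers : Covers (staircase-tuple n′ (suc k)) (λ j → toℕ j < suc k)
  covers j j<k = fromℕ< j<k , subst (_< suc n′) (sym (toℕ-fromℕ< j<k)) (toℕ<n j) ,
    toℕ-injective (begin
      toℕ (staircase {n′} (fromℕ< j<k))  ≡⟨ toℕ-staircase (fromℕ< j<k) ⟩
      toℕ (fromℕ< j<k) ⊓ n′              ≡⟨ cong (_⊓ n′) (toℕ-fromℕ< j<k) ⟩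
      toℕ j ⊓ n′                         ≡⟨ m≤n⇒m⊓n≡m (s≤s⁻¹ (toℕ<n j)) ⟩
      toℕ j                              ∎)

-- Every subset of size at most k is covered by some tuple of [n]^(k):
-- permute it into {j < k} and move the initial tuple back.
covering-tuple : ∀ n k → (k ≤ n ⊎ 1 ≤ n) → (S : Subset n) → ∣ S ∣ ≤ k →
  Σ (Tuples n k) λ x → Covers x (_∈ S)
covering-tuple n k nonempty S ∣S∣≤k =
  actTuple (flip τ) c ,
  λ s s∈S → covers-act (flip τ) c c-covers s (<-≤-trans (τ-gathers s s∈S) ∣S∣≤k)
  where
  τ = proj₁ (gather n S)
  τ-gathers = proj₂ (gather n S)
  c = proj₁ (initial-tuple n k nonempty)
  c-covers = proj₂ (initial-tuple n k nonempty)

Carries : ∀ {n k} → Permutation′ n → Tuples n k → Tuples n k → Set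
Carries {n} π x x′ = ∀ i → Distinct n i → π ⟨$⟩ʳ proj₁ x i ≡ proj₁ x′ i

tuples-transitive : ∀ {n k} (x x′ : Tuples n k) → ∃ λ (π : Permutation′ n) → Carries π x x′
tuples-transitive {n} {k} x x′ =
  extend-to-permutation k (Distinct n) (λ i → toℕ i <? n) (proj₁ x) (proj₁ x′)
    (proj₁ (proj₂ x)) (proj₁ (proj₂ x′))

-- Permutations agreeing on a support S of y move y to the same point:
-- ρ = (ρ ∘ ρ′⁻¹) ∘ ρ′ and ρ ∘ ρ′⁻¹ fixes S pointwise.
support-agree : ∀ {n} (Y : SymSet n) {S : Subset n} {y : Carrier Y} → IsSupport Y S y →
  (ρ ρ′ : Permutation′ n) → (∀ s → s ∈ S → ρ ⟨$⟩ʳ s ≡ ρ′ ⟨$⟩ʳ s) → act Y ρ y ≡ act Y ρ′ y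
support-agree Y {S} {y} supp ρ ρ′ agree = begin
  act Y ρ y                   ≡⟨ act-≈ Y ρ (t ∘ₚ ρ′) (λ _ → sym (inverseʳ ρ′)) y ⟩
  act Y (t ∘ₚ ρ′) y           ≡⟨ act-∘ Y t ρ′ y ⟩
  act Y ρ′ (act Y t y)        ≡⟨ cong (act Y ρ′) (supp t t-fixes) ⟩
  act Y ρ′ y                  ∎
  where
  t = ρ ∘ₚ flip ρ′
  t-fixes : FixesPointwise t S
  t-fixes s s∈S = trans (cong (ρ′ ⟨$⟩ˡ_) (agree s s∈S)) (inverseˡ ρ′)

module OrbitMap {n k} (Y : SymSet n) (y₀ : Carrier Y) (S : Subset n)
  (supp : IsSupport Y S y₀) (x₀ : Tuples n k) (x₀-covers : Covers x₀ (_∈ S)) where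

  orbit-map : Tuples n k → Carrier Y
  orbit-map x = act Y (proj₁ (tuples-transitive x₀ x)) y₀

  orbit-map-unique : ∀ π x → Carries π x₀ x → orbit-map x ≡ act Y π y₀
  orbit-map-unique π x π-carries = support-agree Y supp _ π agree-on-S
    where
    agree-on-S : ∀ s → s ∈ S → proj₁ (tuples-transitive x₀ x) ⟨$⟩ʳ s ≡ π ⟨$⟩ʳ s
    agree-on-S s s∈S with x₀-covers s s∈S
    ... | i , i-distinct , refl =
      trans (proj₂ (tuples-transitive x₀ x) i i-distinct) (sym (π-carries i i-distinct))

  orbit-map-hom : IsHom Y orbit-map
  orbit-map-hom σ x = begin
    orbit-map (actTuple σ x)     ≡⟨ orbit-map-unique (π ∘ₚ σ) (actTuple σ x) σπ-carries ⟩
    act Y (π ∘ₚ σ) y₀            ≡⟨ act-∘ Y π σ y₀ ⟩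
    act Y σ (orbit-map x)        ∎
    where
    π = proj₁ (tuples-transitive x₀ x)
    σπ-carries : Carries (π ∘ₚ σ) x₀ (actTuple σ x)
    σπ-carries i i-distinct = cong (σ ⟨$⟩ʳ_) (proj₂ (tuples-transitive x₀ x) i i-distinct)

  orbit-map-base : orbit-map x₀ ≡ y₀
  orbit-map-base = trans (orbit-map-unique idₚ x₀ (λ _ _ → refl)) (act-id Y y₀)

  orbit-map-surjective : (∀ y → ∃ λ (σ : Permutation′ n) → act Y σ y₀ ≡ y) → Surjective orbit-map
  orbit-map-surjective transitive y with transitive y
  ... | σ , σy₀≡y = actTuple σ x₀ , (begin
    orbit-map (actTuple σ x₀)   ≡⟨ orbit-map-hom σ x₀ ⟩
    act Y σ (orbit-map x₀)      ≡⟨ cong (act Y σ) orbit-map-base ⟩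
    act Y σ y₀                  ≡⟨ σy₀≡y ⟩
    y                           ∎)

lemma4p6 : (n k : ℕ) → (k ≤ n ⊎ 1 ≤ n) → (Y : SymSet n) → SingleOrbit Y → KSupported k Y →
    ∃ λ (f : Tuples n k → Carrier Y) → IsHom Y f × Surjective f
lemma4p6 n k nonempty Y (y₀ , transitive) k-supported with k-supported y₀
... | S , ∣S∣≤k , supp with covering-tuple n k nonempty S ∣S∣≤k
... | x₀ , x₀-covers = orbit-map , orbit-map-hom , orbit-map-surjective (transitive y₀)
  where open OrbitMap Y y₀ S supp x₀ x₀-covers
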